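{- For any two vertices $v_1,v_2$ in a $3$-edge-connected graph $G$, there exists an induced path $P$ in $G$ from $v_1$ to $v_2$ such that $G-E(P)$ is connected.
   Context: All graphs are simple and finite. -}

module Defs where

open import Data.Nat using (ℕ; zero; suc; _≤_; _<_)
open import Data.Fin using (Fin; toℕ; fromℕ; inject₁) renaming (zero to fzero; suc to fsuc)
open import Data.Bool using (Bool; true; false; T)
open import Data.List using (List; length)
open import Data.List.Membership.Propositional using (_∈_)
open import Data.Product using (Σ; ∃; _×_; _,_)
open import Data.Sum using (_⊎_)
open import Relation.Nullary using (¬_)
open import Relation.Binary.PropositionalEquality using (_≡_)
open import Function.Definitions using (Injective)

record Graph (n : ℕ) : Set where
  field
    adj     : Fin n → Fin n → Bool
    adj-sym : ∀ u v → adj u v ≡ adj v u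
    irrefl  : ∀ v → adj v v ≡ false
open Graph public

_─_ : ∀ {n} → Graph n → (Fin n → Fin n → Set) → Fin n → Fin n → Set
(G ─ D) u v = T (adj G u v) × ¬ (D u v ⊎ D v u)

data Walk {n : ℕ} (E : Fin n → Fin n → Set) : Fin n → Fin n → Set where
  here : ∀ {v} → Walk E v v
  step : ∀ {u w v} → E u w → Walk E w v → Walk E u v

Connected : ∀ {n} → (Fin n → Fin n → Set) → Set
Connected {n} E = ∀ (u v : Fin n) → Walk E u v

EdgeList : ℕ → Set
EdgeList n = List (Fin n × Fin n)

InList : ∀ {n} → EdgeList n → Fin n → Fin n → Set
InList F u v = (u , v) ∈ F


-- k-edge-connected (Diestel): |V| ≥ 2 and G − F is connected for every
-- set F of fewer than k edges.
EdgeConnected : ∀ {n} → ℕ → Graph n → Set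
EdgeConnected {n} k G =
  (2 ≤ n) ×
  (∀ (F : EdgeList n) → (∀ {u v} → (u , v) ∈ F → T (adj G u v)) →
     length F < k → Connected (G ─ InList F))

record InducedPath {n : ℕ} (G : Graph n) (k : ℕ) (p : Fin (suc k) → Fin n) : Set where
  field
    distinct : Injective _≡_ _≡_ p
    induced  : ∀ i j → (T (adj G (p i) (p j)) →
                          (toℕ j ≡ suc (toℕ i) ⊎ toℕ i ≡ suc (toℕ j)))
                     × ((toℕ j ≡ suc (toℕ i) ⊎ toℕ i ≡ suc (toℕ j)) →
                          T (adj G (p i) (p j)))

PathEdge : ∀ {n k} → (Fin (suc k) → Fin n) → Fin n → Fin n → Set
PathEdge {k = k} p u v = Σ (Fin k) λ i → (p (inject₁ i) ≡ u) × (p (fsuc i) ≡ v)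

module Submission where

-- Among induced v₁–v₂ paths P, look at the vertices reached from v₁ in G − E(P).  If one is
-- unreached, so is a vertex of P; let p (t+1) be the first.  Deleting the edge p t p (t+1),
-- 2-edge-connectivity yields a later reached vertex p s (take the first); deleting also the edge
-- entering p s, 3-edge-connectivity yields an unreached p a with t < a < s that G − E(P) joins
-- to some p b with b > s.  Replacing P between the first and last of its vertices in the
-- component of p a by an induced path through that (unreached) component keeps every reached
-- vertex reached, and the path edge where P re-enters the reached set before p s becomes a
-- non-path edge.  Thus fewer vertices are unreached, and well-founded recursion ends with none.

open import Defs
open import Data.Nat using (ℕ; zero; suc; _+_; _∸_; _≤_; _<_; z≤n; s≤s; _≤?_; _<?_)
open import Data.Nat.Properties
open import Data.Fin using (Fin; toℕ; fromℕ; fromℕ<) renaming (zero to fzero)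
open import Data.Fin.Properties using (any?; toℕ<n; toℕ-fromℕ; toℕ-fromℕ<; toℕ-inject₁; toℕ-injective)
  renaming (_≟_ to _≟ᶠ_)
open import Data.Fin.Subset using (Subset; ∣_∣) renaming (_∈_ to _∈ˢ_)
open import Data.Fin.Subset.Properties using (p⊂q⇒∣p∣<∣q∣)
open import Data.Bool using (T)
open import Data.Bool.Properties using (T?)
open import Data.Vec using (tabulate)
open import Data.Vec.Properties using (lookup∘tabulate; lookup⇒[]=; []=⇒lookup)
open import Data.List using ([]; _∷_; allFin; length)
open import Data.List.Membership.Propositional using (_∈_)
open import Data.List.Membership.Propositional.Properties using (∈-allFin)
open import Data.List.Relation.Unary.Any using (here; there)
open import Data.Product using (Σ; ∃; ∃₂; _×_; _,_; proj₁; proj₂)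
open import Data.Sum using (_⊎_; inj₁; inj₂; [_,_])
open import Function using (_∘_)
open import Data.Nat.Induction using (<-wellFounded)
open import Induction.WellFounded using (module All)
open import Relation.Binary.Construct.On as On using ()
open import Relation.Nullary using (¬_; Dec; yes; no; does; contradiction)
open import Relation.Nullary.Decidable using (_×-dec_; _⊎-dec_; ¬?; dec-true; decidable-stable)
open import Relation.Unary using (Decidable)
open import Relation.Binary.PropositionalEquality
  using (_≡_; _≢_; refl; sym; trans; cong; subst; subst₂)

module _ {n : ℕ} {E : Fin n → Fin n → Set} where

  infixr 5 _◅◅_
  infixl 5 _▻_

  _◅◅_ : ∀ {u v w} → Walk E u v → Walk E v w → Walk E u w
  here     ◅◅ W′ = W′
  step e W ◅◅ W′ = step e (W ◅◅ W′)

  _▻_ : ∀ {u v w} → Walk E u v → E v w → Walk E u w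
  W ▻ e = W ◅◅ step e here

  reverseʷ : (∀ {u v} → E u v → E v u) → ∀ {u v} → Walk E u v → Walk E v u
  reverseʷ E-sym here       = here
  reverseʷ E-sym (step e W) = reverseʷ E-sym W ▻ E-sym e

  mapʷ : ∀ {E′ : Fin n → Fin n → Set} → (∀ {u v} → E u v → E′ u v) →
         ∀ {u v} → Walk E u v → Walk E′ u v
  mapʷ f here       = here
  mapʷ f (step e W) = step (f e) (mapʷ f W)

  walk-closed : (S : Fin n → Set) → (∀ {u w} → S u → E u w → S w) →
                ∀ {x y} → S x → Walk E x y → S y
  walk-closed S closed s here       = s
  walk-closed S closed s (step e W) = walk-closed S closed (closed s e) W

  walk-escapes : (S : Fin n → Set) {X : Set} → (∀ {u w} → S u → E u w → S w ⊎ X) →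
                 ∀ {x y} → S x → Walk E x y → S y ⊎ X
  walk-escapes S leave s here = inj₁ s
  walk-escapes S leave s (step e W) with leave s e
  ... | inj₁ s′ = walk-escapes S leave s′ W
  ... | inj₂ x  = inj₂ x

  data InnerWalk (P : Fin n → Set) : Fin n → Fin n → Set where
    stay    : ∀ {u} → InnerWalk P u u
    edge    : ∀ {u v} → E u v → InnerWalk P u v
    through : ∀ {u w v} → E u w → P w → InnerWalk P w v → InnerWalk P u v

  private
    inner-weaken : ∀ {P Q : Fin n → Set} → (∀ {x} → P x → Q x) →
                   ∀ {u v} → InnerWalk P u v → InnerWalk Q u v
    inner-weaken f stay             = stay
    inner-weaken f (edge e)         = edge e
    inner-weaken f (through e pw W) = through e (f pw) (inner-weaken f W)

    inner-join : ∀ {P u x v} → InnerWalk P u x → P x → InnerWalk P x v → InnerWalk P u v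
    inner-join stay            px W′ = W′
    inner-join (edge e)        px W′ = through e px W′
    inner-join (through e p W) px W′ = through e p (inner-join W px W′)

    inner-split : ∀ {x L u v} → InnerWalk (_∈ (x ∷ L)) u v →
                  InnerWalk (_∈ L) u v ⊎ (InnerWalk (_∈ L) u x × InnerWalk (_∈ L) x v)
    inner-split stay     = inj₁ stay
    inner-split (edge e) = inj₁ (edge e)
    inner-split (through e w∈ W) with inner-split W | w∈
    ... | inj₁ W′        | here refl = inj₂ (edge e , W′)
    ... | inj₁ W′        | there w∈L = inj₁ (through e w∈L W′)
    ... | inj₂ (_ , W₂)  | here refl = inj₂ (edge e , W₂)
    ... | inj₂ (W₁ , W₂) | there w∈L = inj₂ (through e w∈L W₁ , W₂)

  module _ (E? : ∀ u v → Dec (E u v)) where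

    -- Floyd–Warshall: a walk with inner vertices in x ∷ L avoids x or splits at x.
    inner? : ∀ L u v → Dec (InnerWalk (_∈ L) u v)
    inner? [] u v with u ≟ᶠ v | E? u v
    ... | yes refl | _     = yes stay
    ... | no _     | yes e = yes (edge e)
    ... | no u≢v   | no ¬e = no λ { stay → u≢v refl ; (edge e) → ¬e e }
    inner? (x ∷ L) u v with inner? L u v | inner? L u x | inner? L x v
    ... | yes W | _      | _      = yes (inner-weaken there W)
    ... | no _  | yes W₁ | yes W₂ = yes (inner-join (inner-weaken there W₁) (here refl) (inner-weaken there W₂))
    ... | no ¬W | no ¬W₁ | _      = no ([ ¬W , ¬W₁ ∘ proj₁ ] ∘ inner-split)
    ... | no ¬W | yes _  | no ¬W₂ = no ([ ¬W , ¬W₂ ∘ proj₂ ] ∘ inner-split)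

    walk? : ∀ u v → Dec (Walk E u v)
    walk? u v with inner? (allFin n) u v
    ... | yes W = yes (forget W)
      where
      forget : ∀ {P u v} → InnerWalk P u v → Walk E u v
      forget stay            = here
      forget (edge e)        = step e here
      forget (through e _ W) = step e (forget W)
    ... | no ¬W = no (¬W ∘ inner)
      where
      inner : ∀ {u v} → Walk E u v → InnerWalk (_∈ allFin n) u v
      inner here       = stay
      inner (step e W) = through e (∈-allFin _) (inner W)

module _ {P : ℕ → Set} (P? : Decidable P) where

  least≤ : ∀ k → (∃ λ i → i ≤ k × P i × (∀ j → j < i → ¬ P j)) ⊎ (∀ i → i ≤ k → ¬ P i)
  least≤ zero with P? zero
  ... | yes p = inj₁ (zero , z≤n , p , λ _ ())
  ... | no ¬p = inj₂ λ { zero _ → ¬p }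
  least≤ (suc k) with least≤ k | P? (suc k)
  ... | inj₁ (i , i≤k , p , before) | _ = inj₁ (i , m≤n⇒m≤1+n i≤k , p , before)
  ... | inj₂ none | yes p = inj₁ (suc k , ≤-refl , p , λ j j<1+k → none j (≤-pred j<1+k))
  ... | inj₂ none | no ¬p = inj₂ λ i i≤1+k → [ none i ∘ ≤-pred , (λ { refl → ¬p }) ] (m≤n⇒m<n∨m≡n i≤1+k)

  greatest≤ : ∀ k → (∃ λ i → i ≤ k × P i × (∀ j → i < j → j ≤ k → ¬ P j)) ⊎ (∀ i → i ≤ k → ¬ P i)
  greatest≤ zero with P? zero
  ... | yes p = inj₁ (zero , z≤n , p , λ { _ () z≤n })
  ... | no ¬p = inj₂ λ { zero _ → ¬p }
  greatest≤ (suc k) with P? (suc k) | greatest≤ k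
  ... | yes p | _ = inj₁ (suc k , ≤-refl , p , λ j 1+k<j j≤1+k _ → <⇒≱ 1+k<j j≤1+k)
  ... | no ¬p | inj₁ (i , i≤k , p , after) = inj₁ (i , m≤n⇒m≤1+n i≤k , p , after′)
    where
    after′ : ∀ j → i < j → j ≤ suc k → ¬ P j
    after′ j i<j j≤1+k = [ after j i<j ∘ ≤-pred , (λ { refl → ¬p }) ] (m≤n⇒m<n∨m≡n j≤1+k)
  ... | no ¬p | inj₂ none = inj₂ λ i i≤1+k → [ none i ∘ ≤-pred , (λ { refl → ¬p }) ] (m≤n⇒m<n∨m≡n i≤1+k)

  crossing : ∀ {a b} → a ≤ b → ¬ P a → P b → ∃ λ i → a ≤ i × i < b × ¬ P i × P (suc i)
  crossing {b = zero} z≤n ¬pa pb = contradiction pb ¬pa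
  crossing {a} {suc b} a≤1+b ¬pa pb with m≤n⇒m<n∨m≡n a≤1+b
  ... | inj₂ refl = contradiction pb ¬pa
  ... | inj₁ a<1+b with P? b
  ...   | no ¬pb′ = b , ≤-pred a<1+b , n<1+n b , ¬pb′ , pb
  ...   | yes pb′ with crossing (≤-pred a<1+b) ¬pa pb′
  ...     | i , a≤i , i<b , ¬pi , pi+1 = i , a≤i , m<n⇒m<1+n i<b , ¬pi , pi+1

_~_ : ℕ → ℕ → Set
i ~ j = j ≡ suc i ⊎ i ≡ suc j

~-sym : ∀ {i j} → i ~ j → j ~ i
~-sym (inj₁ e) = inj₂ e
~-sym (inj₂ e) = inj₁ e

~⇒≤suc : ∀ {i j} → i ~ j → j ≤ suc i
~⇒≤suc (inj₁ refl) = ≤-refl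
~⇒≤suc (inj₂ refl) = m≤n⇒m≤1+n (n≤1+n _)

~-crossing : ∀ {i j m} → i ~ j → i < m → m ≤ j → j ≡ suc i × j ≡ m
~-crossing (inj₁ refl) i<m m≤j = refl , ≤-antisym i<m m≤j
~-crossing (inj₂ refl) i<m m≤j = contradiction (<-trans (≤-<-trans m≤j (n<1+n _)) i<m) (<-irrefl refl)

data Position (lo hi i : ℕ) : Set where
  below  : i < lo → Position lo hi i
  inside : lo ≤ i → i < hi → Position lo hi i
  above  : hi ≤ i → Position lo hi i

position : ∀ lo hi i → Position lo hi i
position lo hi i with i <? lo | i <? hi
... | yes i<lo | _        = below i<lo
... | no i≮lo  | yes i<hi = inside (≮⇒≥ i≮lo) i<hi
... | no _     | no i≮hi  = above (≮⇒≥ i≮hi)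

module _ {n : ℕ} where

  subset : {P : Fin n → Set} → Decidable P → Subset n
  subset P? = tabulate (does ∘ P?)

  ∈-subset : {P : Fin n → Set} (P? : Decidable P) → ∀ {x} → P x → x ∈ˢ subset P?
  ∈-subset P? {x} px = lookup⇒[]= x _ (trans (lookup∘tabulate _ x) (dec-true (P? x) px))

  subset-∈ : {P : Fin n → Set} (P? : Decidable P) → ∀ {x} → x ∈ˢ subset P? → P x
  subset-∈ P? {x} x∈ with P? x | trans (sym (lookup∘tabulate (does ∘ P?) x)) ([]=⇒lookup x∈)
  ... | yes px | _ = px

  ∣subset∣-< : {P Q : Fin n → Set} (P? : Decidable P) (Q? : Decidable Q) → (∀ {x} → P x → Q x) →
               ∀ {x} → Q x → ¬ P x → ∣ subset P? ∣ < ∣ subset Q? ∣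
  ∣subset∣-< P? Q? P⊆Q {x} qx ¬px =
    p⊂q⇒∣p∣<∣q∣ (∈-subset Q? ∘ P⊆Q ∘ subset-∈ P? , x , ∈-subset Q? qx , ¬px ∘ subset-∈ P?)

─-sym : ∀ {n} {G : Graph n} {D : Fin n → Fin n → Set} {u v} → (G ─ D) u v → (G ─ D) v u
─-sym {G = G} {u = u} {v} (a , ¬d) = subst T (adj-sym G u v) a , ¬d ∘ [ inj₂ , inj₁ ]

─-anti : ∀ {n} {G : Graph n} {D D′ : Fin n → Fin n → Set} → (∀ {u v} → D′ u v → D u v) →
         ∀ {u v} → (G ─ D) u v → (G ─ D′) u v
─-anti D′⊆D (a , ¬d) = a , ¬d ∘ [ inj₁ ∘ D′⊆D , inj₂ ∘ D′⊆D ]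

module Paths {n : ℕ} (G : Graph n) where

  Adj : Fin n → Fin n → Set
  Adj u v = T (adj G u v)

  Adj-sym : ∀ {u v} → Adj u v → Adj v u
  Adj-sym {u} {v} = subst T (adj-sym G u v)

  Adj-irrefl : ∀ {v} → ¬ Adj v v
  Adj-irrefl {v} = subst T (irrefl G v)

  Adj? : ∀ u v → Dec (Adj u v)
  Adj? u v = T? (adj G u v)

  -- A path with k edges is an index function read on the positions 0, …, k only.
  record IsInducedPath (k : ℕ) (p : ℕ → Fin n) : Set where
    field
      injective : ∀ {i j} → i ≤ k → j ≤ k → p i ≡ p j → i ≡ j
      adj⇒~     : ∀ {i j} → i ≤ k → j ≤ k → Adj (p i) (p j) → i ~ j
      ~-adj     : ∀ {i} → i < k → Adj (p i) (p (suc i))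
  open IsInducedPath public

  record InducedRoute (x y : Fin n) : Set where
    constructor route
    field
      len     : ℕ
      at      : ℕ → Fin n
      induced : IsInducedPath len at
      start   : at 0 ≡ x
      end     : at len ≡ y

  PathEdgeℕ : ℕ → (ℕ → Fin n) → Fin n → Fin n → Set
  PathEdgeℕ k p u v = ∃ λ i → i < k × p i ≡ u × p (suc i) ≡ v

  PathEdgeℕ? : ∀ k p u v → Dec (PathEdgeℕ k p u v)
  PathEdgeℕ? k p u v with any? {n = k} (λ i → (p (toℕ i) ≟ᶠ u) ×-dec (p (suc (toℕ i)) ≟ᶠ v))
  ... | yes (i , e) = yes (toℕ i , toℕ<n i , e)
  ... | no ¬e = no λ { (i , i<k , e) → ¬e (fromℕ< i<k , subst (λ j → p j ≡ u × p (suc j) ≡ v) (sym (toℕ-fromℕ< i<k)) e) }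

  path-edge⇒~ : ∀ {k p u v} → PathEdgeℕ k p u v ⊎ PathEdgeℕ k p v u →
                ∃₂ λ i j → i ≤ k × j ≤ k × i ~ j × p i ≡ u × p j ≡ v
  path-edge⇒~ (inj₁ (i , i<k , e₁ , e₂)) = i , suc i , <⇒≤ i<k , i<k , inj₁ refl , e₁ , e₂
  path-edge⇒~ (inj₂ (i , i<k , e₁ , e₂)) = suc i , i , i<k , <⇒≤ i<k , inj₂ refl , e₂ , e₁

  trivial-induced : ∀ {x} → IsInducedPath 0 (λ _ → x)
  trivial-induced = record
    { injective = λ { z≤n z≤n _ → refl }
    ; adj⇒~     = λ { z≤n z≤n a → contradiction a Adj-irrefl }
    ; ~-adj     = λ () }

  restrict-induced : ∀ {k m p} → m ≤ k → IsInducedPath k p → IsInducedPath m p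
  restrict-induced m≤k P = record
    { injective = λ i≤m j≤m → injective P (≤-trans i≤m m≤k) (≤-trans j≤m m≤k)
    ; adj⇒~     = λ i≤m j≤m → adj⇒~ P (≤-trans i≤m m≤k) (≤-trans j≤m m≤k)
    ; ~-adj     = λ i<m → ~-adj P (<-≤-trans i<m m≤k) }

  shift : ℕ → (ℕ → Fin n) → ℕ → Fin n
  shift b p i = p (b + i)

  shift-induced : ∀ {b m p} → IsInducedPath (b + m) p → IsInducedPath m (shift b p)
  shift-induced {b} {m} {p} P = record
    { injective = λ i≤m j≤m → +-cancelˡ-≡ b _ _ ∘ injective P (+-monoʳ-≤ b i≤m) (+-monoʳ-≤ b j≤m)
    ; adj⇒~     = λ i≤m j≤m → unshift ∘ adj⇒~ P (+-monoʳ-≤ b i≤m) (+-monoʳ-≤ b j≤m)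
    ; ~-adj     = λ {i} i<m → subst (Adj (p (b + i)) ∘ p) (sym (+-suc b i))
                                (~-adj P (subst (_≤ b + m) (+-suc b i) (+-monoʳ-≤ b i<m))) }
    where
    unshift : ∀ {i j} → (b + i) ~ (b + j) → i ~ j
    unshift {i} (inj₁ e) = inj₁ (+-cancelˡ-≡ b _ _ (trans e (sym (+-suc b i))))
    unshift {j = j} (inj₂ e) = inj₂ (+-cancelˡ-≡ b _ _ (trans e (sym (+-suc b j))))

  _◂_ : Fin n → (ℕ → Fin n) → ℕ → Fin n
  (x ◂ p) zero    = x
  (x ◂ p) (suc i) = p i

  ◂-induced : ∀ {k p x} → IsInducedPath k p → Adj x (p 0) →
              (∀ {j} → 0 < j → j ≤ k → x ≢ p j × ¬ Adj x (p j)) → IsInducedPath (suc k) (x ◂ p)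
  ◂-induced {k} {p} {x} P x~p₀ far = record { injective = inj ; adj⇒~ = adj′ ; ~-adj = succ }
    where
    x≢ : ∀ {j} → j ≤ k → x ≢ p j
    x≢ {zero}  _   e = Adj-irrefl (subst (Adj x) (sym e) x~p₀)
    x≢ {suc j} j≤k   = proj₁ (far (s≤s z≤n) j≤k)

    inj : ∀ {i j} → i ≤ suc k → j ≤ suc k → (x ◂ p) i ≡ (x ◂ p) j → i ≡ j
    inj {zero}  {zero}  _ _ _ = refl
    inj {zero}  {suc j} _ j≤ e = contradiction e (x≢ (≤-pred j≤))
    inj {suc i} {zero}  i≤ _ e = contradiction (sym e) (x≢ (≤-pred i≤))
    inj {suc i} {suc j} i≤ j≤ e = cong suc (injective P (≤-pred i≤) (≤-pred j≤) e)

    x~⇒0 : ∀ {j} → j ≤ k → Adj x (p j) → j ≡ 0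
    x~⇒0 {zero}  _   _ = refl
    x~⇒0 {suc j} j≤k a = contradiction a (proj₂ (far (s≤s z≤n) j≤k))

    adj′ : ∀ {i j} → i ≤ suc k → j ≤ suc k → Adj ((x ◂ p) i) ((x ◂ p) j) → i ~ j
    adj′ {zero}  {zero}  _ _ a = contradiction a Adj-irrefl
    adj′ {zero}  {suc j} _ j≤ a = inj₁ (cong suc (x~⇒0 (≤-pred j≤) a))
    adj′ {suc i} {zero}  i≤ _ a = inj₂ (cong suc (x~⇒0 (≤-pred i≤) (Adj-sym a)))
    adj′ {suc i} {suc j} i≤ j≤ a = [ inj₁ ∘ cong suc , inj₂ ∘ cong suc ] (adj⇒~ P (≤-pred i≤) (≤-pred j≤) a)

    succ : ∀ {i} → i < suc k → Adj ((x ◂ p) i) ((x ◂ p) (suc i))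
    succ {zero}  _ = x~p₀
    succ {suc i} i< = ~-adj P (≤-pred i<)

  join : ℕ → (ℕ → Fin n) → (ℕ → Fin n) → ℕ → Fin n
  join k p q i with i ≤? k
  ... | yes _ = p i
  ... | no  _ = q (i ∸ k)

  module _ {k : ℕ} {p q : ℕ → Fin n} where

    join-≤ : ∀ {i} → i ≤ k → join k p q i ≡ p i
    join-≤ {i} i≤k with i ≤? k
    ... | yes _   = refl
    ... | no i≰k = contradiction i≤k i≰k

    join-+ : p k ≡ q 0 → ∀ j → join k p q (k + j) ≡ q j
    join-+ p≡q j with k + j ≤? k
    ... | no _ = cong q (m+n∸m≡n k j)
    ... | yes k+j≤k with j
    ...   | zero   = trans (cong p (+-identityʳ k)) p≡q
    ...   | suc j′ = contradiction k+j≤k (m+1+n≰m k)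

  data JoinView (k₁ k₂ : ℕ) (p q : ℕ → Fin n) (i : ℕ) : Set where
    left  : i ≤ k₁ → join k₁ p q i ≡ p i → JoinView k₁ k₂ p q i
    right : ∀ j → suc j ≤ k₂ → i ≡ k₁ + suc j → join k₁ p q i ≡ q (suc j) → JoinView k₁ k₂ p q i

  join-view : ∀ {k₁ k₂ p q} → p k₁ ≡ q 0 → ∀ i → i ≤ k₁ + k₂ → JoinView k₁ k₂ p q i
  join-view {k₁} {p = p} {q} p≡q i i≤ with i ≤? k₁
  ... | yes i≤k₁ = left i≤k₁ (join-≤ {k₁} {p} {q} i≤k₁)
  ... | no i≰k₁ with i ∸ suc k₁ | sym (trans (+-suc k₁ (i ∸ suc k₁)) (m+[n∸m]≡n (≰⇒> i≰k₁)))
  ...   | j | refl = right j (+-cancelˡ-≤ k₁ _ _ i≤) refl (join-+ {k₁} {p} {q} p≡q (suc j))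

  join-edge : ∀ {k₁ k₂ p q u v} → p k₁ ≡ q 0 → PathEdgeℕ (k₁ + k₂) (join k₁ p q) u v →
              PathEdgeℕ k₁ p u v ⊎ PathEdgeℕ k₂ q u v
  join-edge {k₁} {k₂} {p} {q} {u} {v} p≡q (i , i< , e₁ , e₂) with k₁ ≤? i
  ... | no k₁≰i = inj₁ (i , ≰⇒> k₁≰i , trans (sym (join-≤ {k₁} {p} {q} (<⇒≤ (≰⇒> k₁≰i)))) e₁ ,
                        trans (sym (join-≤ {k₁} {p} {q} (≰⇒> k₁≰i))) e₂)
  ... | yes k₁≤i with i ∸ k₁ | m+[n∸m]≡n k₁≤i
  ...   | j | refl = inj₂ (j , +-cancelˡ-< k₁ _ _ i< , trans (sym (join-+ {k₁} {p} {q} p≡q j)) e₁ ,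
                           trans (sym (join-+ {k₁} {p} {q} p≡q (suc j))) (trans (cong (join k₁ p q) (+-suc k₁ j)) e₂))

  module _ {k₁ k₂ p q} (P : IsInducedPath k₁ p) (Q : IsInducedPath k₂ q) (p≡q : p k₁ ≡ q 0)
           (apart : ∀ {i j} → i < k₁ → 0 < j → j ≤ k₂ → p i ≢ q j × ¬ Adj (p i) (q j)) where

    private
      J = join k₁ p q

      p≢q⁺ : ∀ {i j} → i ≤ k₁ → suc j ≤ k₂ → p i ≢ q (suc j)
      p≢q⁺ i≤k₁ j< with m≤n⇒m<n∨m≡n i≤k₁
      ... | inj₁ i<k₁ = proj₁ (apart i<k₁ (s≤s z≤n) j<)
      ... | inj₂ refl = 0≢1+n ∘ injective Q z≤n j< ∘ trans (sym p≡q)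

      p~q⁺ : ∀ {i j} → i ≤ k₁ → suc j ≤ k₂ → Adj (p i) (q (suc j)) → i ≡ k₁ × j ≡ 0
      p~q⁺ i≤k₁ j< a with m≤n⇒m<n∨m≡n i≤k₁
      ... | inj₁ i<k₁ = contradiction a (proj₂ (apart i<k₁ (s≤s z≤n) j<))
      ... | inj₂ refl with adj⇒~ Q z≤n j< (subst (λ x → Adj x _) p≡q a)
      ...   | inj₁ refl = refl , refl

      inj : ∀ {i j} → i ≤ k₁ + k₂ → j ≤ k₁ + k₂ → J i ≡ J j → i ≡ j
      inj {i} {j} i≤ j≤ e with join-view p≡q i i≤ | join-view p≡q j j≤
      ... | left  i≤k₁ eᵢ | left  j≤k₁ eⱼ = injective P i≤k₁ j≤k₁ (trans (sym eᵢ) (trans e eⱼ))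
      ... | left  i≤k₁ eᵢ | right _ j< refl eⱼ = contradiction (trans (sym eᵢ) (trans e eⱼ)) (p≢q⁺ i≤k₁ j<)
      ... | right _ i< refl eᵢ | left  j≤k₁ eⱼ = contradiction (trans (sym eⱼ) (trans (sym e) eᵢ)) (p≢q⁺ j≤k₁ i<)
      ... | right _ i< refl eᵢ | right _ j< refl eⱼ =
        cong (k₁ +_) (injective Q i< j< (trans (sym eᵢ) (trans e eⱼ)))

      adj′ : ∀ {i j} → i ≤ k₁ + k₂ → j ≤ k₁ + k₂ → Adj (J i) (J j) → i ~ j
      adj′ {i} {j} i≤ j≤ a with join-view p≡q i i≤ | join-view p≡q j j≤
      ... | left i≤k₁ eᵢ | left j≤k₁ eⱼ = adj⇒~ P i≤k₁ j≤k₁ (subst₂ Adj eᵢ eⱼ a)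
      ... | left i≤k₁ eᵢ | right _ j< refl eⱼ with p~q⁺ i≤k₁ j< (subst₂ Adj eᵢ eⱼ a)
      ...   | refl , refl = inj₁ (+-comm k₁ 1)
      adj′ i≤ j≤ a | right _ i< refl eᵢ | left j≤k₁ eⱼ with p~q⁺ j≤k₁ i< (Adj-sym (subst₂ Adj eᵢ eⱼ a))
      ...   | refl , refl = inj₂ (+-comm k₁ 1)
      adj′ i≤ j≤ a | right i′ i< refl eᵢ | right j′ j< refl eⱼ
        with adj⇒~ Q i< j< (subst₂ Adj eᵢ eⱼ a)
      ... | inj₁ e = inj₁ (trans (cong (k₁ +_) e) (+-suc k₁ (suc i′)))
      ... | inj₂ e = inj₂ (trans (cong (k₁ +_) e) (+-suc k₁ (suc j′)))

      succ-right : ∀ {i} j → i ≡ k₁ + j → i < k₁ + k₂ → Adj (J i) (J (suc i))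
      succ-right j refl i< =
        subst₂ Adj (sym (join-+ {k₁} {p} {q} p≡q j)) (sym (trans (cong J (sym (+-suc k₁ j))) (join-+ {k₁} {p} {q} p≡q (suc j))))
               (~-adj Q (+-cancelˡ-< k₁ _ _ i<))

      succ : ∀ {i} → i < k₁ + k₂ → Adj (J i) (J (suc i))
      succ {i} i< with k₁ ≤? i
      ... | yes k₁≤i = succ-right (i ∸ k₁) (sym (m+[n∸m]≡n k₁≤i)) i<
      ... | no k₁≰i = subst₂ Adj (sym (join-≤ {k₁} {p} {q} (<⇒≤ (≰⇒> k₁≰i)))) (sym (join-≤ {k₁} {p} {q} (≰⇒> k₁≰i)))
                              (~-adj P (≰⇒> k₁≰i))

    join-induced : IsInducedPath (k₁ + k₂) (join k₁ p q)
    join-induced = record { injective = inj ; adj⇒~ = adj′ ; ~-adj = succ }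

  InducedRouteIn : (Fin n → Fin n → Set) → Fin n → Fin n → Set
  InducedRouteIn E x y = Σ (InducedRoute x y) λ R → ∀ i → i ≤ InducedRoute.len R → Walk E x (InducedRoute.at R i)

  -- The walk's first vertex is attached to the last vertex of the shortcut rest that equals or
  -- neighbours it.
  shortcut : ∀ {E : Fin n → Fin n → Set} → (∀ {u v} → E u v → Adj u v) → ∀ {x y} → Walk E x y →
             InducedRouteIn E x y
  shortcut E⊆Adj {x} here = route 0 (λ _ → x) trivial-induced refl refl , λ _ _ → here
  shortcut {E} E⊆Adj {x} {y} (step e W) with shortcut E⊆Adj W
  ... | route m r r-induced r₀ rₘ , r-within
    with greatest≤ (λ j → (r j ≟ᶠ x) ⊎-dec Adj? x (r j)) m
  ...   | inj₂ none = contradiction (inj₂ (subst (Adj x) (sym r₀) (E⊆Adj e))) (none 0 z≤n)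
  ...   | inj₁ (j , j≤m , hit , after) = prepend hit
    where
    d = m ∸ j
    j+d≡m : j + d ≡ m
    j+d≡m = m+[n∸m]≡n j≤m

    tail-induced : IsInducedPath d (shift j r)
    tail-induced = shift-induced (subst (λ l → IsInducedPath l r) (sym j+d≡m) r-induced)

    tail₀ : shift j r 0 ≡ r j
    tail₀ = cong r (+-identityʳ j)

    tail-end : shift j r d ≡ y
    tail-end = trans (cong r j+d≡m) rₘ

    tail-within : ∀ i → i ≤ d → Walk E x (shift j r i)
    tail-within i i≤d = step e (r-within (j + i) (subst (j + i ≤_) j+d≡m (+-monoʳ-≤ j i≤d)))

    far : ∀ {i} → 0 < i → i ≤ d → x ≢ shift j r i × ¬ Adj x (shift j r i)
    far {i} 0<i i≤d = (λ e → hit′ (inj₁ (sym e))) , hit′ ∘ inj₂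
      where hit′ = after (j + i) (m<m+n j 0<i) (subst (j + i ≤_) j+d≡m (+-monoʳ-≤ j i≤d))

    prepend : r j ≡ x ⊎ Adj x (r j) → InducedRouteIn E x y
    prepend (inj₁ rⱼ≡x) = route d (shift j r) tail-induced (trans tail₀ rⱼ≡x) tail-end , tail-within
    prepend (inj₂ x~rⱼ) =
      route (suc d) (x ◂ shift j r) (◂-induced tail-induced (subst (Adj x) (sym tail₀) x~rⱼ) far) refl tail-end ,
      λ { zero _ → here ; (suc i) i< → tail-within i (≤-pred i<) }

  PathEdge⇒PathEdgeℕ : ∀ {k p u v} → PathEdge {k = k} (p ∘ toℕ) u v → PathEdgeℕ k p u v
  PathEdge⇒PathEdgeℕ {p = p} (i , e₁ , e₂) = toℕ i , toℕ<n i , trans (cong p (sym (toℕ-inject₁ i))) e₁ , e₂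

  residual-toℕ : ∀ {k p u v} → (G ─ PathEdgeℕ k p) u v → (G ─ PathEdge (p ∘ toℕ)) u v
  residual-toℕ {k} {p} = ─-anti {G = G} {D = PathEdgeℕ k p} (PathEdge⇒PathEdgeℕ {k} {p})

  induced-toℕ : ∀ {k p} → IsInducedPath k p → InducedPath G k (p ∘ toℕ)
  induced-toℕ {k} {p} P = record
    { distinct = λ e → toℕ-injective (injective P (bound _) (bound _) e)
    ; induced  = λ i j → adj⇒~ P (bound i) (bound j) , ~⇒adj i j }
    where
    bound : ∀ (i : Fin (suc k)) → toℕ i ≤ k
    bound i = ≤-pred (toℕ<n i)

    ~⇒adj : ∀ i j → toℕ i ~ toℕ j → Adj (p (toℕ i)) (p (toℕ j))
    ~⇒adj i j (inj₁ e) = subst (Adj (p (toℕ i)) ∘ p) (sym e) (~-adj P (subst (_≤ k) e (bound j)))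
    ~⇒adj i j (inj₂ e) = Adj-sym (subst (Adj (p (toℕ j)) ∘ p) (sym e) (~-adj P (subst (_≤ k) e (bound i))))

module Main {n : ℕ} (G : Graph n) (ec : EdgeConnected 3 G) (v₁ v₂ : Fin n) where

  open Paths G

  Route : Set
  Route = InducedRoute v₁ v₂

  connected-without : (F : EdgeList n) → (∀ {u v} → (u , v) ∈ F → Adj u v) →
                      length F < 3 → Connected (G ─ InList F)
  connected-without = proj₂ ec

  module _ (P : Route) where
    open InducedRoute P renaming (len to k; at to p)

    Residual : Fin n → Fin n → Set
    Residual = G ─ PathEdgeℕ k p

    Residual? : ∀ u v → Dec (Residual u v)
    Residual? u v = Adj? u v ×-dec ¬? (PathEdgeℕ? k p u v ⊎-dec PathEdgeℕ? k p v u)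

    residual-sym : ∀ {u v} → Residual u v → Residual v u
    residual-sym = ─-sym {G = G} {D = PathEdgeℕ k p}

    Reached : Fin n → Set
    Reached = Walk Residual v₁

    Reached? : Decidable Reached
    Reached? = walk? Residual? v₁

    unreached : ℕ
    unreached = ∣ subset (¬? ∘ Reached?) ∣

    residual-or-consecutive : ∀ {u w} → Adj u w →
      Residual u w ⊎ ∃₂ λ i j → i ≤ k × j ≤ k × i ~ j × p i ≡ u × p j ≡ w
    residual-or-consecutive {u} {w} a with PathEdgeℕ? k p u w ⊎-dec PathEdgeℕ? k p w u
    ... | yes on-path = inj₂ (path-edge⇒~ on-path)
    ... | no off-path = inj₁ (a , off-path)

  module Improve (P : Route) where
    open InducedRoute P renaming (len to k; at to p)

    reached-start : Reached P (p 0)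
    reached-start = subst (Reached P) (sym start) here

    reached-back : ∀ {x y} → Walk (Residual P) x y → Reached P y → Reached P x
    reached-back W r = r ◅◅ reverseʷ (residual-sym P) W

    path-reached⇒all-reached : (∀ i → i ≤ k → Reached P (p i)) → ∀ x → Reached P x
    path-reached⇒all-reached all-i x =
      walk-closed (Reached P) extend here (connected-without [] (λ ()) (s≤s z≤n) v₁ x)
      where
      extend : ∀ {u w} → Reached P u → (G ─ InList []) u w → Reached P w
      extend r (a , _) with residual-or-consecutive P a
      ... | inj₁ res = r ▻ res
      ... | inj₂ (_ , j , _ , j≤k , _ , _ , refl) = all-i j j≤k

    first-unreached : ∀ {x₀} → ¬ Reached P x₀ →
      ∃ λ t → suc t ≤ k × ¬ Reached P (p (suc t)) × (∀ j → j ≤ t → Reached P (p j))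
    first-unreached ¬r with least≤ (¬? ∘ Reached? P ∘ p) k
    ... | inj₂ none =
      contradiction (path-reached⇒all-reached (λ i i≤k → decidable-stable (Reached? P _) (none i i≤k)) _) ¬r
    ... | inj₁ (zero , _ , ¬r₀ , _) = contradiction reached-start ¬r₀
    ... | inj₁ (suc t , t<k , ¬rₜ₊₁ , before) =
      t , t<k , ¬rₜ₊₁ , λ j j≤t → decidable-stable (Reached? P _) (before j (s≤s j≤t))

    record Detour : Set where
      field
        {a s b}     : ℕ
        a<s         : a < s
        s<b         : s < b
        b≤k         : b ≤ k
        unreached-a : ¬ Reached P (p a)
        reached-s   : Reached P (p s)
        link        : Walk (Residual P) (p a) (p b)

    module _ {t} (t<k : suc t ≤ k) (before : ∀ j → j ≤ t → Reached P (p j)) where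

      -- By 2-edge-connectivity v₁ still reaches p (t+1) once the edge p t p (t+1) is deleted;
      -- along the way the reached part of the path can only be left through that edge.
      unreached-suffix-impossible : ¬ (∀ i → suc t ≤ i → i ≤ k → ¬ Reached P (p i))
      unreached-suffix-impossible suffix =
        suffix (suc t) ≤-refl t<k
          (walk-closed (Reached P) extend here (connected-without F F⊆G (s≤s (s≤s z≤n)) v₁ (p (suc t))))
        where
        F : EdgeList n
        F = (p t , p (suc t)) ∷ []

        F⊆G : ∀ {u v} → (u , v) ∈ F → Adj u v
        F⊆G (here refl) = ~-adj induced t<k

        reached-index : ∀ {i} → i ≤ k → Reached P (p i) → i < suc t
        reached-index {i} i≤k r with i <? suc t
        ... | yes i<t+1 = i<t+1
        ... | no i≮t+1  = contradiction r (suffix i (≮⇒≥ i≮t+1) i≤k)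

        extend : ∀ {u w} → Reached P u → (G ─ InList F) u w → Reached P w
        extend r (a , ¬F) with residual-or-consecutive P a
        ... | inj₁ res = r ▻ res
        ... | inj₂ (i , j , i≤k , j≤k , i~j , refl , refl) with j <? suc t
        ...   | yes j<t+1 = before j (≤-pred j<t+1)
        ...   | no j≮t+1 with ~-crossing i~j (reached-index i≤k r) (≮⇒≥ j≮t+1)
        ...     | refl , refl = contradiction (inj₁ (here refl)) ¬F

      private
        unreached-from : ¬ Reached P (p (suc t)) →
                         ∀ i → suc t ≤ i → ¬ (suc t < i × Reached P (p i)) → ¬ Reached P (p i)
        unreached-from ¬rₜ₊₁ i t<i not-later r with m≤n⇒m<n∨m≡n t<i
        ... | inj₁ t+1<i = not-later (t+1<i , r)
        ... | inj₂ refl  = ¬rₜ₊₁ r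

      next-reached : ¬ Reached P (p (suc t)) →
        ∃ λ s → suc t < s × s ≤ k × Reached P (p s) × (∀ j → suc t ≤ j → j < s → ¬ Reached P (p j))
      next-reached ¬rₜ₊₁ with least≤ (λ i → (suc t <? i) ×-dec Reached? P (p i)) k
      ... | inj₂ none = contradiction (λ i t<i i≤k → unreached-from ¬rₜ₊₁ i t<i (none i i≤k))
                                      unreached-suffix-impossible
      ... | inj₁ (s , s≤k , (t+1<s , rₛ) , min) =
        s , t+1<s , s≤k , rₛ , λ j t<j j<s → unreached-from ¬rₜ₊₁ j t<j (min j j<s)

      -- By 3-edge-connectivity p (t+1) still reaches v₁ once the two path edges bounding the
      -- unreached stretch t+1, …, s-1 are deleted, so the residual component of that stretch
      -- is left through a path edge beyond s.
      module _ {s′} (t+1<s : suc t < suc s′) (s≤k : suc s′ ≤ k) (rₛ : Reached P (p (suc s′)))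
               (gap : ∀ j → suc t ≤ j → j < suc s′ → ¬ Reached P (p j)) where

        private
          F : EdgeList n
          F = (p t , p (suc t)) ∷ (p s′ , p (suc s′)) ∷ []

          F⊆G : ∀ {u v} → (u , v) ∈ F → Adj u v
          F⊆G (here refl)         = ~-adj induced t<k
          F⊆G (there (here refl)) = ~-adj induced s≤k

          Stretch : Fin n → Set
          Stretch u = ∃ λ a → suc t ≤ a × a < suc s′ × Walk (Residual P) (p a) u

          Exit : Set
          Exit = ∃₂ λ a b → suc t ≤ a × a < suc s′ × suc s′ < b × b ≤ k × Walk (Residual P) (p a) (p b)

          stretch-unreached : ∀ {u} → Stretch u → ¬ Reached P u
          stretch-unreached (a , t<a , a<s , W) = gap a t<a a<s ∘ reached-back W

          entering : ∀ {i j} → i ≡ suc j × i ≡ suc t → (p j , p i) ∈ F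
          entering (refl , refl) = here refl

          leaving : ∀ {i j} → j ≡ suc i × j ≡ suc s′ → (p i , p j) ∈ F
          leaving (refl , refl) = there (here refl)

          leave : ∀ {u w} → Stretch u → (G ─ InList F) u w → Stretch w ⊎ Exit
          leave st@(a , t<a , a<s , W) (adj , ¬F) with residual-or-consecutive P adj
          ... | inj₁ res = inj₁ (a , t<a , a<s , W ▻ res)
          ... | inj₂ (i , j , i≤k , j≤k , i~j , refl , refl) with position (suc t) (suc s′) i
          ...   | below i<t+1 = contradiction (before i (≤-pred i<t+1)) (stretch-unreached st)
          ...   | above s≤i with m≤n⇒m<n∨m≡n s≤i
          ...     | inj₁ s<i  = inj₂ (a , i , t<a , a<s , s<i , i≤k , W)
          ...     | inj₂ refl = contradiction rₛ (stretch-unreached st)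
          leave st (adj , ¬F) | inj₂ (i , j , i≤k , j≤k , i~j , refl , refl) | inside t<i i<s
            with position (suc t) (suc s′) j
          ... | inside t<j j<s = inj₁ (j , t<j , j<s , here)
          ... | below j<t+1 = contradiction (inj₂ (entering (~-crossing (~-sym i~j) j<t+1 t<i))) ¬F
          ... | above s≤j   = contradiction (inj₁ (leaving (~-crossing i~j i<s s≤j))) ¬F

        detour : Detour
        detour with walk-escapes Stretch leave (suc t , ≤-refl , t+1<s , here)
                      (connected-without F F⊆G (s≤s (s≤s (s≤s z≤n))) (p (suc t)) v₁)
        ... | inj₁ st = contradiction here (stretch-unreached st)
        ... | inj₂ (a , b , t<a , a<s , s<b , b≤k , W) = record
          { a<s = a<s ; s<b = s<b ; b≤k = b≤k
          ; unreached-a = gap a t<a a<s ; reached-s = rₛ ; link = W }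

    module Reroute (D : Detour) where
      open Detour D

      Comp : Fin n → Set
      Comp = Walk (Residual P) (p a)

      comp-unreached : ∀ {x} → Comp x → ¬ Reached P x
      comp-unreached c = unreached-a ∘ reached-back c

      a≤k : a ≤ k
      a≤k = ≤-trans (<⇒≤ (<-trans a<s s<b)) b≤k

      leave-comp : ∀ {j x} → j ≤ k → ¬ Comp (p j) → Comp x → Adj (p j) x →
                   ∃ λ j′ → j′ ≤ k × j ~ j′ × p j′ ≡ x
      leave-comp j≤k ¬c c adj with residual-or-consecutive P adj
      ... | inj₁ res = contradiction (c ▻ residual-sym P res) ¬c
      ... | inj₂ (i , j′ , i≤k , j′≤k , i~j′ , pᵢ≡pⱼ , pⱼ′≡x) with injective induced i≤k j≤k pᵢ≡pⱼ
      ...   | refl = j′ , j′≤k , i~j′ , pⱼ′≡x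

      module Splice {a′ b′} (b′≤k : b′ ≤ k) (comp-a′ : Comp (p a′)) (comp-b′ : Comp (p b′))
                    (before-a′ : ∀ j → j < a′ → ¬ Comp (p j))
                    (after-b′ : ∀ j → b′ < j → j ≤ k → ¬ Comp (p j)) where

        a′≤a : a′ ≤ a
        a′≤a with a <? a′
        ... | yes a<a′ = contradiction here (before-a′ a a<a′)
        ... | no a≮a′  = ≮⇒≥ a≮a′

        b≤b′ : b ≤ b′
        b≤b′ with b′ <? b
        ... | yes b′<b = contradiction link (after-b′ b b′<b b≤k)
        ... | no b′≮b  = ≮⇒≥ b′≮b

        a′≤k : a′ ≤ k
        a′≤k = ≤-trans a′≤a a≤k

        a′<b′ : a′ < b′
        a′<b′ = ≤-<-trans a′≤a (<-≤-trans (<-trans a<s s<b) b≤b′)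

        bypass : InducedRouteIn (Residual P) (p a′) (p b′)
        bypass = shortcut proj₁ (reverseʷ (residual-sym P) comp-a′ ◅◅ comp-b′)

        open InducedRoute (proj₁ bypass) using ()
          renaming (len to m; at to r; induced to r-induced; start to r₀; end to rₘ)

        comp-r : ∀ i → i ≤ m → Comp (r i)
        comp-r i i≤m = comp-a′ ◅◅ proj₂ bypass i i≤m

        p≡r : p a′ ≡ r 0
        p≡r = sym r₀

        front-apart : ∀ {i j} → i < a′ → 0 < j → j ≤ m → p i ≢ r j × ¬ Adj (p i) (r j)
        front-apart {i} {j} i<a′ 0<j j≤m = (λ e → before-a′ i i<a′ (subst Comp (sym e) (comp-r j j≤m))) , apart
          where
          apart : ¬ Adj (p i) (r j)
          apart adj with leave-comp (<⇒≤ (<-≤-trans i<a′ a′≤k)) (before-a′ i i<a′) (comp-r j j≤m) adj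
          ... | j′ , _ , i~j′ , pⱼ′≡rⱼ with a′ ≤? j′
          ...   | no a′≰j′ = before-a′ j′ (≰⇒> a′≰j′) (subst Comp (sym pⱼ′≡rⱼ) (comp-r j j≤m))
          ...   | yes a′≤j′ with ~-crossing i~j′ i<a′ a′≤j′
          ...     | _ , refl = <-irrefl (sym (injective r-induced j≤m z≤n (trans (sym pⱼ′≡rⱼ) p≡r))) 0<j

        front : ℕ → Fin n
        front = join a′ p r

        front-induced : IsInducedPath (a′ + m) front
        front-induced = join-induced (restrict-induced a′≤k induced) r-induced p≡r front-apart

        d : ℕ
        d = k ∸ b′

        b′+d≡k : b′ + d ≡ k
        b′+d≡k = m+[n∸m]≡n b′≤k

        back : ℕ → Fin n
        back = shift b′ p

        back-induced : IsInducedPath d back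
        back-induced = shift-induced (subst (λ l → IsInducedPath l p) (sym b′+d≡k) induced)

        front≡back : front (a′ + m) ≡ back 0
        front≡back = trans (join-+ {a′} {p} {r} p≡r m) (trans rₘ (cong p (sym (+-identityʳ b′))))

        b′+j≤k : ∀ {j} → j ≤ d → b′ + j ≤ k
        b′+j≤k j≤d = subst (_ ≤_) b′+d≡k (+-monoʳ-≤ b′ j≤d)

        back-apart : ∀ {i j} → i < a′ + m → 0 < j → j ≤ d → front i ≢ back j × ¬ Adj (front i) (back j)
        back-apart {i} {j} i< 0<j j≤d with join-view {a′} {m} {p} {r} p≡r i (<⇒≤ i<)
        ... | left i≤a′ eᵢ =
          (λ e → <-irrefl (injective induced i≤k (b′+j≤k j≤d) (trans (sym eᵢ) e)) (<-trans (n<1+n i) far)) ,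
          (λ adj → <⇒≱ far (~⇒≤suc (adj⇒~ induced i≤k (b′+j≤k j≤d) (subst (λ x → Adj x _) eᵢ adj))))
          where
          i≤k : i ≤ k
          i≤k = ≤-trans i≤a′ a′≤k

          far : suc i < b′ + j
          far = ≤-<-trans (≤-trans (s≤s i≤a′) a′<b′) (m<m+n b′ 0<j)
        ... | right j″ j″<m refl eᵢ = (λ e → ¬comp (subst Comp (trans (sym eᵢ) e) (comp-r _ j″<m))) , apart
          where
          ¬comp : ¬ Comp (p (b′ + j))
          ¬comp = after-b′ (b′ + j) (m<m+n b′ 0<j) (b′+j≤k j≤d)

          apart : ¬ Adj (front i) (back j)
          apart adj with leave-comp (b′+j≤k j≤d) ¬comp (comp-r _ j″<m) (Adj-sym (subst (λ x → Adj x _) eᵢ adj))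
          ... | j₃ , j₃≤k , ~j₃ , pⱼ₃≡r with b′ <? j₃
          ...   | yes b′<j₃ = after-b′ j₃ b′<j₃ j₃≤k (subst Comp (sym pⱼ₃≡r) (comp-r _ j″<m))
          ...   | no b′≮j₃ with ~-crossing (~-sym ~j₃) (s≤s (≮⇒≥ b′≮j₃)) (m<m+n b′ 0<j)
          ...     | e₁ , e₂ with suc-injective (trans (sym e₁) e₂)
          ...       | refl = <-irrefl (injective r-induced j″<m ≤-refl (trans (sym pⱼ₃≡r) (sym rₘ)))
                                      (+-cancelˡ-< a′ _ _ i<)

        spliced : Route
        spliced = route (a′ + m + d) (join (a′ + m) front back)
                        (join-induced front-induced back-induced front≡back back-apart)
                        (trans (join-≤ {a′ + m} {front} {back} z≤n) (trans (join-≤ {a′} {p} {r} z≤n) start))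
                        (trans (join-+ {a′ + m} {front} {back} front≡back d) (trans (cong p b′+d≡k) end))

        KeptEdge : Fin n → Fin n → Set
        KeptEdge u w = ∃ λ i → i < k × (i < a′ ⊎ b′ ≤ i) × p i ≡ u × p (suc i) ≡ w

        kept⇒path-edge : ∀ {u w} → KeptEdge u w → PathEdgeℕ k p u w
        kept⇒path-edge (i , i<k , _ , e) = i , i<k , e

        spliced-edge : ∀ {u w} → PathEdgeℕ (a′ + m + d) (join (a′ + m) front back) u w →
                       KeptEdge u w ⊎ (Comp u × Comp w)
        spliced-edge e with join-edge {a′ + m} {d} {front} {back} front≡back e
        ... | inj₂ (i , i<d , e₁ , e₂) =
          inj₁ (b′ + i , subst (b′ + i <_) b′+d≡k (+-monoʳ-< b′ i<d) , inj₂ (m≤m+n b′ i) ,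
                e₁ , trans (cong p (sym (+-suc b′ i))) e₂)
        ... | inj₁ e′ with join-edge {a′} {m} {p} {r} p≡r e′
        ...   | inj₁ (i , i<a′ , e₁ , e₂) = inj₁ (i , <-≤-trans i<a′ a′≤k , inj₁ i<a′ , e₁ , e₂)
        ...   | inj₂ (i , i<m , e₁ , e₂) =
          inj₂ (subst Comp e₁ (comp-r i (<⇒≤ i<m)) , subst Comp e₂ (comp-r (suc i) i<m))

        residual-kept : ∀ {u w} → Reached P u → Residual P u w → Residual spliced u w
        residual-kept r (adj , off) = adj , λ
          { (inj₁ e) → [ off ∘ inj₁ ∘ kept⇒path-edge , (λ c → comp-unreached (proj₁ c) r) ] (spliced-edge e)
          ; (inj₂ e) → [ off ∘ inj₂ ∘ kept⇒path-edge , (λ c → comp-unreached (proj₂ c) r) ] (spliced-edge e) }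

        reached-⊆ : ∀ {x} → Reached P x → Reached spliced x
        reached-⊆ W = proj₂ (walk-closed (λ u → Reached P u × Reached spliced u)
                                         (λ { (r , r′) e → r ▻ e , r′ ▻ residual-kept r e }) (here , here) W)

        gain : ∃ λ x → ¬ Reached P x × Reached spliced x
        gain with crossing (Reached? P ∘ p) (≤-trans a′≤a (<⇒≤ a<s)) (comp-unreached comp-a′) reached-s
        ... | i , a′≤i , i<s , ¬rᵢ , rᵢ₊₁ = p i , ¬rᵢ , reached-⊆ rᵢ₊₁ ▻ re-entry
          where
          i<k : i < k
          i<k = <-trans i<s (<-≤-trans s<b b≤k)

          not-kept : ¬ (i < a′ ⊎ b′ ≤ i)
          not-kept (inj₁ i<a′) = <-irrefl refl (<-≤-trans i<a′ a′≤i)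
          not-kept (inj₂ b′≤i) = <-irrefl refl (<-≤-trans i<s (≤-trans (<⇒≤ s<b) (≤-trans b≤b′ b′≤i)))

          forward : ¬ PathEdgeℕ (a′ + m + d) (join (a′ + m) front back) (p i) (p (suc i))
          forward e with spliced-edge e
          ... | inj₂ (_ , c) = comp-unreached c rᵢ₊₁
          ... | inj₁ (j , j<k , kept , e₁ , _) with injective induced (<⇒≤ j<k) (<⇒≤ i<k) e₁
          ...   | refl = not-kept kept

          backward : ¬ PathEdgeℕ (a′ + m + d) (join (a′ + m) front back) (p (suc i)) (p i)
          backward e with spliced-edge e
          ... | inj₂ (c , _) = comp-unreached c rᵢ₊₁
          ... | inj₁ (j , j<k , _ , e₁ , e₂) with injective induced (<⇒≤ j<k) i<k e₁
          ...   | refl = <-irrefl (sym (injective induced j<k (<⇒≤ i<k) e₂)) (m<n⇒m<1+n (n<1+n i))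

          re-entry : Residual spliced (p (suc i)) (p i)
          re-entry = Adj-sym (~-adj induced i<k) , [ backward , forward ]

        improvement : Σ Route λ Q → unreached Q < unreached P
        improvement with gain
        ... | x , ¬r , r′ = spliced , ∣subset∣-< (¬? ∘ Reached? spliced) (¬? ∘ Reached? P)
                                                 (λ ¬r′ → ¬r′ ∘ reached-⊆) ¬r (λ ¬r′ → ¬r′ r′)

      improvement : Σ Route λ Q → unreached Q < unreached P
      improvement with least≤ (walk? (Residual? P) (p a) ∘ p) k | greatest≤ (walk? (Residual? P) (p a) ∘ p) k
      ... | inj₂ none | _ = contradiction here (none a a≤k)
      ... | _ | inj₂ none = contradiction here (none a a≤k)
      ... | inj₁ (a′ , _ , comp-a′ , before-a′) | inj₁ (b′ , b′≤k , comp-b′ , after-b′) =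
        Splice.improvement b′≤k comp-a′ comp-b′ before-a′ after-b′

    improve : ∀ {x₀} → ¬ Reached P x₀ → Σ Route λ Q → unreached Q < unreached P
    improve ¬r with first-unreached ¬r
    ... | t , t<k , ¬rₜ₊₁ , before with next-reached t<k before ¬rₜ₊₁
    ...   | zero , () , _
    ...   | suc s′ , t+1<s , s≤k , rₛ , gap = Reroute.improvement (detour t<k before t+1<s s≤k rₛ gap)

  open Improve using (improve)

  initial : Route
  initial = proj₁ (shortcut proj₁ (connected-without [] (λ ()) (s≤s z≤n) v₁ v₂))

  FullyReached : Set
  FullyReached = Σ Route λ P → ∀ x → Reached P x

  fully-reached : Route → FullyReached
  fully-reached = All.wfRec (On.wellFounded unreached <-wellFounded) _ _ improve-until-reached
    where
    improve-until-reached : ∀ P → (∀ {Q} → unreached Q < unreached P → FullyReached) → FullyReached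
    improve-until-reached P recurse with any? (¬? ∘ Reached? P)
    ... | no none      = P , λ x → decidable-stable (Reached? P x) (λ ¬r → none (x , ¬r))
    ... | yes (_ , ¬r) with improve P ¬r
    ...   | Q , Q≺P = recurse {Q} Q≺P

  reached⇒connected : ∀ P → (∀ x → Reached P x) → Connected (Residual P)
  reached⇒connected P reached u v = reverseʷ (residual-sym P) (reached u) ◅◅ reached v

lemma4p3 : ∀ {n} (G : Graph n) → EdgeConnected 3 G → (v₁ v₂ : Fin n) →
    Σ ℕ λ k → Σ (Fin (suc k) → Fin n) λ p →
      InducedPath G k p × (p fzero ≡ v₁) × (p (fromℕ k) ≡ v₂) ×
      Connected (G ─ PathEdge p)
lemma4p3 G ec v₁ v₂ with Main.fully-reached G ec v₁ v₂ (Main.initial G ec v₁ v₂)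
... | P@(Paths.route k p induced start end) , reached =
  k , p ∘ toℕ , Paths.induced-toℕ G induced , start , trans (cong p (toℕ-fromℕ k)) end ,
  λ u v → mapʷ (Paths.residual-toℕ G) (Main.reached⇒connected G ec v₁ v₂ P reached u v)
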